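{- Let $q$ be a prime power and let $f=xg$ where $g\in\mathbb{F}_q[x]$ is a permutation polynomial with $g(0)=0$. Then $f$ is projectively equivalent to the polynomial $xh$, where $h$ is the permutation polynomial with $h(0)=0$ satisfying $h(x)=\big(g^{ -1}(x^{ -1})\big)^{ -1}$ for all $x\in\mathbb{F}_q^*$ (here $g^{ -1}$ denotes the compositional inverse of the permutation induced by $g$).
   Context: For $u\in\mathbb{F}_q[x]$, $S_u=\{(x,u(x),1):x\in\mathbb{F}_q\}\cup\{(0,1,0)\}\subset\mathrm{PG}(2,q)$, the projective plane over $\mathbb{F}_q$. Two polynomials $u_1,u_2$ are projectively equivalent if some collineation of $\mathrm{PG}(2,q)$ (element of $\mathrm{P\Gamma L}(3,q)$) maps $S_{u_1}$ onto $S_{u_2}$. A permutation polynomial is one inducing a bijection of $\mathbb{F}_q$. -}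

module Defs where

open import Level using (0ℓ)
open import Data.Product using (Σ; ∃; _×_; _,_)
open import Data.Sum using (_⊎_)
open import Data.List using (List; []; _∷_)
open import Data.List.Membership.Propositional using (_∈_)
open import Relation.Nullary using (¬_; Dec)
open import Relation.Binary.PropositionalEquality using (_≡_; _≢_)
open import Algebra.Structures using (IsCommutativeRing)
open import Function.Definitions using (Bijective)

-- A finite field F_q (q = number of elements, necessarily a prime power),
-- with propositional equality as the equality of the field.
record FiniteField : Set₁ where
  infixl 6 _+_
  infixl 7 _*_
  field
    Carrier : Set
    _+_ _*_ : Carrier → Carrier → Carrier
    -_      : Carrier → Carrier
    0# 1#   : Carrier
    isCommutativeRing : IsCommutativeRing _≡_ _+_ _*_ -_ 0# 1#
    _⁻¹     : Carrier → Carrier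
    ⁻¹-inverse : ∀ x → x ≢ 0# → x * (x ⁻¹) ≡ 1#
    0≢1     : 0# ≢ 1#
    _≟_     : (x y : Carrier) → Dec (x ≡ y)
    elements : List Carrier
    complete : ∀ x → x ∈ elements

module _ (F : FiniteField) where
  open FiniteField F

  -- Polynomials in F[x]: coefficient lists, constant term first.
  Poly : Set
  Poly = List Carrier

  eval : Poly → Carrier → Carrier
  eval []       x = 0#
  eval (c ∷ cs) x = c + x * eval cs x

  xTimes : Poly → Poly
  xTimes g = 0# ∷ g

  IsPermPoly : Poly → Set
  IsPermPoly g = Bijective _≡_ _≡_ (eval g)

  Vec3 : Set
  Vec3 = Carrier × Carrier × Carrier

  NonZero3 : Vec3 → Set
  NonZero3 (a , b , c) = ¬ (a ≡ 0# × b ≡ 0# × c ≡ 0#)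

  scale : Carrier → Vec3 → Vec3
  scale l (a , b , c) = (l * a , l * b , l * c)

  SamePoint : Vec3 → Vec3 → Set
  SamePoint v w = NonZero3 v × NonZero3 w × Σ Carrier (λ l → l ≢ 0# × scale l v ≡ w)

  InS : Poly → Vec3 → Set
  InS u v = (Σ Carrier λ x → SamePoint v (x , eval u x , 1#)) ⊎ SamePoint v (0# , 1# , 0#)

  -- 3×3 matrices (as triples of rows)
  Mat3 : Set
  Mat3 = Vec3 × Vec3 × Vec3

  dot : Vec3 → Vec3 → Carrier
  dot (a , b , c) (d , e , f) = a * d + b * e + c * f

  apply : Mat3 → Vec3 → Vec3
  apply (r₁ , r₂ , r₃) v = (dot r₁ v , dot r₂ v , dot r₃ v)

  det : Mat3 → Carrier
  det ((a , b , c) , (d , e , f) , (g , h , i)) =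
    a * (e * i + - (f * h)) + - (b * (d * i + - (f * g))) + c * (d * h + - (e * g))

  IsFieldAut : (Carrier → Carrier) → Set
  IsFieldAut σ = Bijective _≡_ _≡_ σ
               × (∀ a b → σ (a + b) ≡ σ a + σ b)
               × (∀ a b → σ (a * b) ≡ σ a * σ b)
               × σ 1# ≡ 1#

  map3 : (Carrier → Carrier) → Vec3 → Vec3
  map3 σ (a , b , c) = (σ a , σ b , σ c)

  -- the collineation [v] ↦ [M σ(v)] of PG(2,q), an element of PΓL(3,q)
  collin : (Carrier → Carrier) → Mat3 → Vec3 → Vec3
  collin σ M v = apply M (map3 σ v)

  ProjEquiv : Poly → Poly → Set
  ProjEquiv u₁ u₂ =
    Σ (Carrier → Carrier) λ σ → Σ Mat3 λ M →
      IsFieldAut σ × det M ≢ 0#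
      × (∀ v → InS u₁ v → InS u₂ (collin σ M v))
      × (∀ w → InS u₂ w → Σ Vec3 λ v → InS u₁ v × SamePoint (collin σ M v) w)

  -- h(0) = 0 and h(x) = (g⁻¹(x⁻¹))⁻¹ for all x ∈ F*, where g⁻¹ is the
  -- compositional inverse of the permutation induced by g
  -- (written out: whenever g(y) = x⁻¹, h(x) = y⁻¹)
  IsInvDual : Poly → Poly → Set
  IsInvDual g h = eval h 0# ≡ 0#
    × (∀ x → x ≢ 0# → ∀ y → eval g y ≡ x ⁻¹ → eval h x ≡ y ⁻¹)

{-# OPTIONS --safe #-}
-- The collineation (x : y : z) ↦ (x : z : y) realises the equivalence.  It sends the affine point
-- (s, s g(s), 1), s ≠ 0, to (s : 1 : s g(s)) = (t, t h(t), 1) with t = g(s)⁻¹, because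
-- h(g(s)⁻¹) = s⁻¹; it swaps (0,0,1) with the point at infinity (0,1,0).  The relation
-- between g and h is symmetric, so the same collineation maps S_{xh} into S_{xg}.
-- The polynomial h exists because x ↦ (g⁻¹(x⁻¹))⁻¹, 0 ↦ 0, is a composite of
-- permutations, and every function on a finite field is a polynomial (interpolation).
module Submission where

open import Defs
open import Level using (0ℓ)
open import Data.Product using (Σ; _×_; _,_; proj₁; proj₂)
open import Data.Sum using (inj₁; inj₂)
open import Data.Empty using (⊥-elim)
open import Data.List using (List; []; _∷_)
open import Data.List.Relation.Unary.Any using (here; there)
open import Data.List.Membership.Propositional using (_∈_; _∉_)
open import Relation.Nullary using (yes; no)
open import Relation.Binary.PropositionalEquality
  using (_≡_; _≢_; _≗_; refl; sym; trans; cong; cong₂; setoid; module ≡-Reasoning)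
open import Algebra.Structures using (IsCommutativeRing)
open import Algebra.Bundles using (CommutativeRing)
open import Function.Base using (_∘_; id)
open import Function.Definitions using (Bijective)
import Function.Construct.Composition as Composition
import Function.Construct.Symmetry as Symmetry
import Algebra.Consequences.Setoid as SetoidConsequences
import Algebra.Properties.CommutativeSemigroup as CommutativeSemigroupProperties
import Algebra.Properties.AbelianGroup as AbelianGroupProperties
import Algebra.Solver.Ring.NaturalCoefficients.Default as SemiringSolver
import Data.List.Membership.DecPropositional as DecMembership

bijective-resp-≗ : {A B : Set} {f f′ : A → B} →
                   f ≗ f′ → Bijective _≡_ _≡_ f → Bijective _≡_ _≡_ f′
bijective-resp-≗ {f′ = f′} f≗f′ (injective , surjective) = injective′ , surjective′
  where
  injective′ : ∀ {x y} → f′ x ≡ f′ y → x ≡ y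
  injective′ e = injective (trans (f≗f′ _) (trans e (sym (f≗f′ _))))
  surjective′ : ∀ y → Σ _ λ x → ∀ {z} → z ≡ x → f′ z ≡ y
  surjective′ y = proj₁ (surjective y) ,
                  λ { refl → trans (sym (f≗f′ _)) (proj₂ (surjective y) refl) }

module FieldArithmetic (F : FiniteField) where
  open FiniteField F
  open IsCommutativeRing isCommutativeRing
    using (*-comm; *-assoc; *-identityˡ; *-identityʳ; zeroʳ; +-identityʳ; -‿inverseʳ)
  open ≡-Reasoning

  commutativeRing : CommutativeRing 0ℓ 0ℓ
  commutativeRing = record { isCommutativeRing = isCommutativeRing }

  ⁻¹-inverseˡ : ∀ {x} → x ≢ 0# → x ⁻¹ * x ≡ 1#
  ⁻¹-inverseˡ {x} x≢0 = trans (*-comm (x ⁻¹) x) (⁻¹-inverse x x≢0)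

  *-cancelˡ-nonzero : ∀ {x y z} → x ≢ 0# → x * y ≡ x * z → y ≡ z
  *-cancelˡ-nonzero {x} {y} {z} x≢0 xy≡xz = begin
    y               ≡⟨ sym (*-identityˡ y) ⟩
    1# * y          ≡⟨ cong (_* y) (sym (⁻¹-inverseˡ x≢0)) ⟩
    x ⁻¹ * x * y    ≡⟨ *-assoc (x ⁻¹) x y ⟩
    x ⁻¹ * (x * y)  ≡⟨ cong (x ⁻¹ *_) xy≡xz ⟩
    x ⁻¹ * (x * z)  ≡⟨ sym (*-assoc (x ⁻¹) x z) ⟩
    x ⁻¹ * x * z    ≡⟨ cong (_* z) (⁻¹-inverseˡ x≢0) ⟩
    1# * z          ≡⟨ *-identityˡ z ⟩
    z               ∎

  *-nonzero : ∀ {x y} → x ≢ 0# → y ≢ 0# → x * y ≢ 0#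
  *-nonzero {x} {y} x≢0 y≢0 xy≡0 = y≢0 (*-cancelˡ-nonzero x≢0 (trans xy≡0 (sym (zeroʳ x))))

  ⁻¹-nonzero : ∀ {x} → x ≢ 0# → x ⁻¹ ≢ 0#
  ⁻¹-nonzero {x} x≢0 x⁻¹≡0 = 0≢1 (begin
    0#        ≡⟨ sym (zeroʳ x) ⟩
    x * 0#    ≡⟨ cong (x *_) (sym x⁻¹≡0) ⟩
    x * x ⁻¹  ≡⟨ ⁻¹-inverse x x≢0 ⟩
    1#        ∎)

  ⁻¹-involutive : ∀ {x} → x ≢ 0# → x ⁻¹ ⁻¹ ≡ x
  ⁻¹-involutive {x} x≢0 = *-cancelˡ-nonzero (⁻¹-nonzero x≢0)
    (trans (⁻¹-inverse (x ⁻¹) (⁻¹-nonzero x≢0)) (sym (⁻¹-inverseˡ x≢0)))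

  x*y⁻¹*y≡x : ∀ x {y} → y ≢ 0# → x * y ⁻¹ * y ≡ x
  x*y⁻¹*y≡x x {y} y≢0 = begin
    x * y ⁻¹ * y    ≡⟨ *-assoc x (y ⁻¹) y ⟩
    x * (y ⁻¹ * y)  ≡⟨ cong (x *_) (⁻¹-inverseˡ y≢0) ⟩
    x * 1#          ≡⟨ *-identityʳ x ⟩
    x               ∎

  1≢0 : 1# ≢ 0#
  1≢0 = 0≢1 ∘ sym

  -1≢0 : - 1# ≢ 0#
  -1≢0 -1≡0 = 0≢1 (sym (begin
    1#         ≡⟨ sym (+-identityʳ 1#) ⟩
    1# + 0#    ≡⟨ cong (1# +_) (sym -1≡0) ⟩
    1# + - 1#  ≡⟨ -‿inverseʳ 1# ⟩
    0#         ∎))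

module Interpolation (F : FiniteField) where
  open FiniteField F
  open IsCommutativeRing isCommutativeRing
    using (+-assoc; +-identityˡ; +-identityʳ; -‿inverseʳ; zeroˡ; zeroʳ)
  open FieldArithmetic F using (commutativeRing; 1≢0; *-nonzero; x*y⁻¹*y≡x)
  open ≡-Reasoning

  open SemiringSolver (CommutativeRing.commutativeSemiring commutativeRing)
    using (solve; _:+_; _:*_; _:=_)
  open AbelianGroupProperties (CommutativeRing.+-abelianGroup commutativeRing)
    using (xyx⁻¹≈y; x∙y⁻¹≈ε⇒x≈y)
  open DecMembership _≟_ using (_∈?_)

  infixl 6 _+ₚ_
  infixr 7 _·ₚ_

  _+ₚ_ : Poly F → Poly F → Poly F
  []       +ₚ q        = q
  (a ∷ p)  +ₚ []       = a ∷ p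
  (a ∷ p)  +ₚ (b ∷ q)  = a + b ∷ p +ₚ q

  _·ₚ_ : Carrier → Poly F → Poly F
  c ·ₚ []       = []
  c ·ₚ (a ∷ p)  = c * a ∷ c ·ₚ p

  mulLinear : Carrier → Poly F → Poly F
  mulLinear b p = xTimes F p +ₚ (- b) ·ₚ p

  eval-+ₚ : ∀ p q x → eval F (p +ₚ q) x ≡ eval F p x + eval F q x
  eval-+ₚ []      q       x = sym (+-identityˡ _)
  eval-+ₚ (a ∷ p) []      x = sym (+-identityʳ _)
  eval-+ₚ (a ∷ p) (b ∷ q) x = begin
    a + b + x * eval F (p +ₚ q) x              ≡⟨ cong (λ r → a + b + x * r) (eval-+ₚ p q x) ⟩
    a + b + x * (eval F p x + eval F q x)      ≡⟨ solve 5 (λ a b x P Q → a :+ b :+ x :* (P :+ Q) := a :+ x :* P :+ (b :+ x :* Q))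
                                                    refl a b x (eval F p x) (eval F q x) ⟩
    a + x * eval F p x + (b + x * eval F q x)  ∎

  eval-·ₚ : ∀ c p x → eval F (c ·ₚ p) x ≡ c * eval F p x
  eval-·ₚ c []      x = sym (zeroʳ c)
  eval-·ₚ c (a ∷ p) x = begin
    c * a + x * eval F (c ·ₚ p) x  ≡⟨ cong (λ r → c * a + x * r) (eval-·ₚ c p x) ⟩
    c * a + x * (c * eval F p x)   ≡⟨ solve 4 (λ c a x P → c :* a :+ x :* (c :* P) := c :* (a :+ x :* P))
                                          refl c a x (eval F p x) ⟩
    c * (a + x * eval F p x)       ∎

  eval-mulLinear : ∀ b p x → eval F (mulLinear b p) x ≡ (x + - b) * eval F p x
  eval-mulLinear b p x = begin
    eval F (xTimes F p +ₚ (- b) ·ₚ p) x          ≡⟨ eval-+ₚ (xTimes F p) ((- b) ·ₚ p) x ⟩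
    0# + x * eval F p x + eval F ((- b) ·ₚ p) x  ≡⟨ cong₂ _+_ (+-identityˡ _) (eval-·ₚ (- b) p x) ⟩
    x * eval F p x + - b * eval F p x            ≡⟨ solve 3 (λ x c P → x :* P :+ c :* P := (x :+ c) :* P)
                                                      refl x (- b) (eval F p x) ⟩
    (x + - b) * eval F p x                       ∎

  record Interpolant (φ : Carrier → Carrier) (nodes : List Carrier) : Set where
    field
      poly nodal      : Poly F
      poly-agrees     : ∀ {a} → a ∈ nodes → eval F poly a ≡ φ a
      nodal-vanishes  : ∀ {a} → a ∈ nodes → eval F nodal a ≡ 0#
      nodal-nonzero   : ∀ {x} → x ∉ nodes → eval F nodal x ≢ 0#

  -- Newton's step: the nodal polynomial vanishes at the old nodes, so adding a multiple
  -- of it fixes the value at b without disturbing the others.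
  extendInterpolant : ∀ {φ nodes b} → b ∉ nodes → Interpolant φ nodes → Interpolant φ (b ∷ nodes)
  extendInterpolant {φ} {nodes} {b} b∉ I = record
    { poly = poly +ₚ c ·ₚ nodal
    ; nodal = mulLinear b nodal
    ; poly-agrees = agrees
    ; nodal-vanishes = vanishes
    ; nodal-nonzero = nonzero
    }
    where
    open Interpolant I
    c : Carrier
    c = (φ b + - eval F poly b) * eval F nodal b ⁻¹

    eval-poly′ : ∀ a → eval F (poly +ₚ c ·ₚ nodal) a ≡ eval F poly a + c * eval F nodal a
    eval-poly′ a = trans (eval-+ₚ poly (c ·ₚ nodal) a) (cong (eval F poly a +_) (eval-·ₚ c nodal a))

    agrees : ∀ {a} → a ∈ b ∷ nodes → eval F (poly +ₚ c ·ₚ nodal) a ≡ φ a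
    agrees (here refl) = begin
      eval F (poly +ₚ c ·ₚ nodal) b            ≡⟨ eval-poly′ b ⟩
      eval F poly b + c * eval F nodal b       ≡⟨ cong (eval F poly b +_) (x*y⁻¹*y≡x _ (nodal-nonzero b∉)) ⟩
      eval F poly b + (φ b + - eval F poly b)  ≡⟨ sym (+-assoc _ _ _) ⟩
      eval F poly b + φ b + - eval F poly b    ≡⟨ xyx⁻¹≈y _ _ ⟩
      φ b                                      ∎
    agrees {a} (there a∈) = begin
      eval F (poly +ₚ c ·ₚ nodal) a            ≡⟨ eval-poly′ a ⟩
      eval F poly a + c * eval F nodal a       ≡⟨ cong (λ r → eval F poly a + c * r) (nodal-vanishes a∈) ⟩
      eval F poly a + c * 0#                   ≡⟨ trans (cong (eval F poly a +_) (zeroʳ c)) (+-identityʳ _) ⟩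
      eval F poly a                            ≡⟨ poly-agrees a∈ ⟩
      φ a                                      ∎

    vanishes : ∀ {a} → a ∈ b ∷ nodes → eval F (mulLinear b nodal) a ≡ 0#
    vanishes (here refl) = begin
      eval F (mulLinear b nodal) b   ≡⟨ eval-mulLinear b nodal b ⟩
      (b + - b) * eval F nodal b     ≡⟨ cong (_* eval F nodal b) (-‿inverseʳ b) ⟩
      0# * eval F nodal b            ≡⟨ zeroˡ _ ⟩
      0#                             ∎
    vanishes {a} (there a∈) = begin
      eval F (mulLinear b nodal) a   ≡⟨ eval-mulLinear b nodal a ⟩
      (a + - b) * eval F nodal a     ≡⟨ cong ((a + - b) *_) (nodal-vanishes a∈) ⟩
      (a + - b) * 0#                 ≡⟨ zeroʳ _ ⟩
      0#                             ∎

    nonzero : ∀ {x} → x ∉ b ∷ nodes → eval F (mulLinear b nodal) x ≢ 0#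
    nonzero {x} x∉ = *-nonzero (x∉ ∘ here ∘ x∙y⁻¹≈ε⇒x≈y x b) (nodal-nonzero (x∉ ∘ there))
                   ∘ trans (sym (eval-mulLinear b nodal x))

  interpolant : ∀ φ nodes → Interpolant φ nodes
  interpolant φ [] = record
    { poly = []
    ; nodal = 1# ∷ []
    ; poly-agrees = λ ()
    ; nodal-vanishes = λ ()
    ; nodal-nonzero = λ {x} _ 1+x*0≡0 → 1≢0 (trans (sym (trans (cong (1# +_) (zeroʳ x)) (+-identityʳ 1#))) 1+x*0≡0)
    }
  interpolant φ (b ∷ nodes) with b ∈? nodes
  ... | no b∉ = extendInterpolant b∉ (interpolant φ nodes)
  ... | yes b∈ = record
    { poly = poly
    ; nodal = nodal
    ; poly-agrees = λ { (here refl) → poly-agrees b∈ ; (there a∈) → poly-agrees a∈ }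
    ; nodal-vanishes = λ { (here refl) → nodal-vanishes b∈ ; (there a∈) → nodal-vanishes a∈ }
    ; nodal-nonzero = λ x∉ → nodal-nonzero (x∉ ∘ there)
    }
    where open Interpolant (interpolant φ nodes)

  interpolate : ∀ φ → Σ (Poly F) λ p → eval F p ≗ φ
  interpolate φ = poly , λ x → poly-agrees (complete x)
    where open Interpolant (interpolant φ elements)

module DualPermutation (F : FiniteField) where
  open FiniteField F
  open FieldArithmetic F using (⁻¹-nonzero; ⁻¹-involutive)
  open Interpolation F using (interpolate)
  open ≡-Reasoning

  inv₀ : Carrier → Carrier
  inv₀ x with x ≟ 0#
  ... | yes _ = 0#
  ... | no  _ = x ⁻¹

  inv₀-zero : inv₀ 0# ≡ 0#
  inv₀-zero with 0# ≟ 0#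
  ... | yes _   = refl
  ... | no 0≢0  = ⊥-elim (0≢0 refl)

  inv₀-nonzero : ∀ {x} → x ≢ 0# → inv₀ x ≡ x ⁻¹
  inv₀-nonzero {x} x≢0 with x ≟ 0#
  ... | yes x≡0 = ⊥-elim (x≢0 x≡0)
  ... | no  _   = refl

  inv₀-involutive : ∀ x → inv₀ (inv₀ x) ≡ x
  inv₀-involutive x with x ≟ 0#
  ... | yes refl = inv₀-zero
  ... | no  x≢0  = trans (inv₀-nonzero (⁻¹-nonzero x≢0)) (⁻¹-involutive x≢0)

  inv₀-bijective : Bijective _≡_ _≡_ inv₀
  inv₀-bijective = SetoidConsequences.selfInverse⇒bijective (setoid Carrier)
    (λ { refl → inv₀-involutive _ })

  DualOnUnits : Poly F → Poly F → Set
  DualOnUnits g h = ∀ {s} → s ≢ 0# → eval F g s ≢ 0# × eval F h (eval F g s ⁻¹) ≡ s ⁻¹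

  module _ (g : Poly F) (g-perm : IsPermPoly F g) (g-0 : eval F g 0# ≡ 0#) where

    g⁻¹ : Carrier → Carrier
    g⁻¹ = proj₁ ∘ proj₂ g-perm

    g∘g⁻¹ : ∀ y → eval F g (g⁻¹ y) ≡ y
    g∘g⁻¹ y = proj₂ (proj₂ g-perm y) refl

    g⁻¹∘g : ∀ x → g⁻¹ (eval F g x) ≡ x
    g⁻¹∘g x = proj₁ g-perm (g∘g⁻¹ (eval F g x))

    g-nonzero : ∀ {x} → x ≢ 0# → eval F g x ≢ 0#
    g-nonzero x≢0 gx≡0 = x≢0 (proj₁ g-perm (trans gx≡0 (sym g-0)))

    dual : Carrier → Carrier
    dual = inv₀ ∘ g⁻¹ ∘ inv₀

    dual-bijective : Bijective _≡_ _≡_ dual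
    dual-bijective = Composition.bijective _≡_ _≡_ _≡_ inv₀-bijective
      (Composition.bijective _≡_ _≡_ _≡_
        (Symmetry.bijective g-perm refl sym trans (cong _)) inv₀-bijective)

    dual-isInvDual : ∀ h → eval F h ≗ dual → IsInvDual F g h
    dual-isInvDual h h≗dual = h-0 , h-dual
      where
      h-0 : eval F h 0# ≡ 0#
      h-0 = begin
        eval F h 0#               ≡⟨ h≗dual 0# ⟩
        inv₀ (g⁻¹ (inv₀ 0#))      ≡⟨ cong (inv₀ ∘ g⁻¹) (trans inv₀-zero (sym g-0)) ⟩
        inv₀ (g⁻¹ (eval F g 0#))  ≡⟨ cong inv₀ (g⁻¹∘g 0#) ⟩
        inv₀ 0#                   ≡⟨ inv₀-zero ⟩
        0#                        ∎
      h-dual : ∀ x → x ≢ 0# → ∀ y → eval F g y ≡ x ⁻¹ → eval F h x ≡ y ⁻¹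
      h-dual x x≢0 y gy≡x⁻¹ = begin
        eval F h x               ≡⟨ h≗dual x ⟩
        inv₀ (g⁻¹ (inv₀ x))      ≡⟨ cong (inv₀ ∘ g⁻¹) (trans (inv₀-nonzero x≢0) (sym gy≡x⁻¹)) ⟩
        inv₀ (g⁻¹ (eval F g y))  ≡⟨ cong inv₀ (g⁻¹∘g y) ⟩
        inv₀ y                   ≡⟨ inv₀-nonzero y≢0 ⟩
        y ⁻¹                     ∎
        where
        y≢0 : y ≢ 0#
        y≢0 y≡0 = ⁻¹-nonzero x≢0 (trans (sym gy≡x⁻¹) (trans (cong (eval F g) y≡0) g-0))

    dualPermPoly : Σ (Poly F) λ h → IsPermPoly F h × IsInvDual F g h
    dualPermPoly = h , bijective-resp-≗ (sym ∘ h≗dual) dual-bijective , dual-isInvDual h h≗dual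
      where
      h : Poly F
      h = proj₁ (interpolate dual)
      h≗dual : eval F h ≗ dual
      h≗dual = proj₂ (interpolate dual)

    isInvDual⇒dualOnUnits : ∀ h → IsInvDual F g h → DualOnUnits g h
    isInvDual⇒dualOnUnits h (_ , h-dual) {s} s≢0 =
      gs≢0 , h-dual _ (⁻¹-nonzero gs≢0) s (sym (⁻¹-involutive gs≢0))
      where
      gs≢0 : eval F g s ≢ 0#
      gs≢0 = g-nonzero s≢0

    isInvDual⇒dualOnUnits-flipped : ∀ h → IsInvDual F g h → DualOnUnits h g
    isInvDual⇒dualOnUnits-flipped h (_ , h-dual) {t} t≢0 = ht≢0 , (begin
      eval F g (eval F h t ⁻¹)  ≡⟨ cong (λ z → eval F g (z ⁻¹)) ht≡y⁻¹ ⟩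
      eval F g (y ⁻¹ ⁻¹)        ≡⟨ cong (eval F g) (⁻¹-involutive y≢0) ⟩
      eval F g y                ≡⟨ g∘g⁻¹ (t ⁻¹) ⟩
      t ⁻¹                      ∎)
      where
      y : Carrier
      y = g⁻¹ (t ⁻¹)
      y≢0 : y ≢ 0#
      y≢0 y≡0 = ⁻¹-nonzero t≢0 (trans (sym (g∘g⁻¹ (t ⁻¹))) (trans (cong (eval F g) y≡0) g-0))
      ht≡y⁻¹ : eval F h t ≡ y ⁻¹
      ht≡y⁻¹ = h-dual t t≢0 y (g∘g⁻¹ (t ⁻¹))
      ht≢0 : eval F h t ≢ 0#
      ht≢0 = ⁻¹-nonzero y≢0 ∘ trans (sym ht≡y⁻¹)

module ProjectivePoints (F : FiniteField) where
  open FiniteField F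
  open IsCommutativeRing isCommutativeRing using (*-identityˡ; *-assoc)
  open FieldArithmetic F using (*-nonzero; 1≢0)

  nonZero-affine : ∀ {a b} → NonZero3 F (a , b , 1#)
  nonZero-affine (_ , _ , 1≡0) = 1≢0 1≡0

  nonZero-middle : ∀ {a c} → NonZero3 F (a , 1# , c)
  nonZero-middle (_ , 1≡0 , _) = 1≢0 1≡0

  scale-one : ∀ v → scale F 1# v ≡ v
  scale-one (a , b , c) = cong₂ _,_ (*-identityˡ a) (cong₂ _,_ (*-identityˡ b) (*-identityˡ c))

  scale-* : ∀ l m v → scale F (l * m) v ≡ scale F l (scale F m v)
  scale-* l m (a , b , c) = cong₂ _,_ (*-assoc l m a) (cong₂ _,_ (*-assoc l m b) (*-assoc l m c))

  samePoint-refl : ∀ {v} → NonZero3 F v → SamePoint F v v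
  samePoint-refl {v} v≢0 = v≢0 , v≢0 , 1# , 1≢0 , scale-one v

  ≡⇒samePoint : ∀ {v w} → NonZero3 F w → v ≡ w → SamePoint F v w
  ≡⇒samePoint w≢0 refl = samePoint-refl w≢0

  samePoint-trans : ∀ {u v w} → SamePoint F u v → SamePoint F v w → SamePoint F u w
  samePoint-trans {u} (u≢0 , _ , l , l≢0 , lu≡v) (_ , w≢0 , m , m≢0 , mv≡w) =
    u≢0 , w≢0 , m * l , *-nonzero m≢0 l≢0 , trans (scale-* m l u) (trans (cong (scale F m) lu≡v) mv≡w)

  inS-nonZero : ∀ {u v} → InS F u v → NonZero3 F v
  inS-nonZero (inj₁ (_ , v≢0 , _)) = v≢0
  inS-nonZero (inj₂ (v≢0 , _))     = v≢0

  inS-resp : ∀ {u v w} → SamePoint F v w → InS F u w → InS F u v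
  inS-resp v~w (inj₁ (x , w~P)) = inj₁ (x , samePoint-trans v~w w~P)
  inS-resp v~w (inj₂ w~∞)       = inj₂ (samePoint-trans v~w w~∞)

module SwapCollineation (F : FiniteField) where
  open FiniteField F
  open IsCommutativeRing isCommutativeRing
    using (*-comm; *-identityˡ; *-identityʳ; zeroˡ; +-identityˡ; +-identityʳ)
  open FieldArithmetic F using (commutativeRing; *-nonzero; ⁻¹-nonzero; ⁻¹-inverseˡ; -1≢0)
  open DualPermutation F using (DualOnUnits)
  open ProjectivePoints F
  open CommutativeSemigroupProperties (CommutativeRing.*-commutativeSemigroup commutativeRing)
    using (interchange; xy∙z≈y∙xz)
  open AbelianGroupProperties (CommutativeRing.+-abelianGroup commutativeRing) using (ε⁻¹≈ε)
  open ≡-Reasoning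

  swap : Vec3 F → Vec3 F
  swap (a , b , c) = a , c , b

  0+0*x≡0 : ∀ x → 0# + 0# * x ≡ 0#
  0+0*x≡0 x = trans (+-identityˡ _) (zeroˡ x)

  e₁ e₂ e₃ : Vec3 F
  e₁ = 1# , 0# , 0#
  e₂ = 0# , 1# , 0#
  e₃ = 0# , 0# , 1#

  swapMatrix : Mat3 F
  swapMatrix = e₁ , e₃ , e₂

  dot-e₁ : ∀ a b c → dot F e₁ (a , b , c) ≡ a
  dot-e₁ a b c = begin
    1# * a + 0# * b + 0# * c  ≡⟨ cong₂ _+_ (cong₂ _+_ (*-identityˡ a) (zeroˡ b)) (zeroˡ c) ⟩
    a + 0# + 0#               ≡⟨ trans (+-identityʳ _) (+-identityʳ a) ⟩
    a                         ∎

  dot-e₂ : ∀ a b c → dot F e₂ (a , b , c) ≡ b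
  dot-e₂ a b c = begin
    0# * a + 1# * b + 0# * c  ≡⟨ cong₂ _+_ (cong₂ _+_ (zeroˡ a) (*-identityˡ b)) (zeroˡ c) ⟩
    0# + b + 0#               ≡⟨ trans (+-identityʳ _) (+-identityˡ b) ⟩
    b                         ∎

  dot-e₃ : ∀ a b c → dot F e₃ (a , b , c) ≡ c
  dot-e₃ a b c = begin
    0# * a + 0# * b + 1# * c  ≡⟨ cong₂ _+_ (cong₂ _+_ (zeroˡ a) (zeroˡ b)) (*-identityˡ c) ⟩
    0# + 0# + c               ≡⟨ trans (cong (_+ c) (+-identityʳ 0#)) (+-identityˡ c) ⟩
    c                         ∎

  collin-swapMatrix : ∀ v → collin F id swapMatrix v ≡ swap v
  collin-swapMatrix (a , b , c) = cong₂ _,_ (dot-e₁ a b c) (cong₂ _,_ (dot-e₃ a b c) (dot-e₂ a b c))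

  det-swapMatrix : det F swapMatrix ≡ - 1#
  det-swapMatrix = begin
    1# * (0# * 0# + - (1# * 1#)) + - (0# * (0# * 0# + - (1# * 0#))) + 0# * (0# * 1# + - (0# * 0#))
      ≡⟨ cong₂ _+_ (cong₂ _+_ (*-identityˡ _) (trans (cong -_ (zeroˡ _)) ε⁻¹≈ε)) (zeroˡ _) ⟩
    0# * 0# + - (1# * 1#) + 0# + 0#
      ≡⟨ trans (+-identityʳ _) (+-identityʳ _) ⟩
    0# * 0# + - (1# * 1#)
      ≡⟨ cong₂ _+_ (zeroˡ 0#) (cong -_ (*-identityˡ 1#)) ⟩
    0# + - 1#
      ≡⟨ +-identityˡ (- 1#) ⟩
    - 1#
      ∎

  id-isFieldAut : IsFieldAut F id
  id-isFieldAut = (id , λ y → y , id) , (λ _ _ → refl) , (λ _ _ → refl) , refl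

  nonZero-swap : ∀ {v} → NonZero3 F v → NonZero3 F (swap v)
  nonZero-swap {a , b , c} v≢0 (a≡0 , c≡0 , b≡0) = v≢0 (a≡0 , b≡0 , c≡0)

  samePoint-swap : ∀ {v w} → SamePoint F v w → SamePoint F (swap v) (swap w)
  samePoint-swap {a , b , c} (v≢0 , w≢0 , l , l≢0 , lv≡w) =
    nonZero-swap v≢0 , nonZero-swap w≢0 , l , l≢0 , cong swap lv≡w

  swap-projEquiv : ∀ u w → (∀ v → InS F u v → InS F w (swap v)) →
                   (∀ v → InS F w v → InS F u (swap v)) → ProjEquiv F u w
  swap-projEquiv u w u→w w→u =
    id , swapMatrix , id-isFieldAut , -1≢0 ∘ trans (sym det-swapMatrix) , forward , backward
    where
    forward : ∀ v → InS F u v → InS F w (collin F id swapMatrix v)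
    forward v v∈ = inS-resp {w} (≡⇒samePoint (nonZero-swap (inS-nonZero {u} v∈)) (collin-swapMatrix v))
                            (u→w v v∈)
    backward : ∀ x → InS F w x → Σ (Vec3 F) λ v → InS F u v × SamePoint F (collin F id swapMatrix v) x
    backward x x∈ = swap x , w→u x x∈ , ≡⇒samePoint (inS-nonZero {w} x∈) (collin-swapMatrix (swap x))

  swap-affinePoint-inS : ∀ g h → DualOnUnits g h → ∀ s →
                     InS F (xTimes F h) (swap (s , eval F (xTimes F g) s , 1#))
  swap-affinePoint-inS g h dual s with s ≟ 0#
  ... | yes refl = inj₂ (≡⇒samePoint nonZero-middle (cong (λ z → 0# , 1# , z) (0+0*x≡0 (eval F g 0#))))
  ... | no s≢0 = inj₁ (t , nonZero-middle , nonZero-affine , l , l≢0 ,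
                       cong₂ _,_ ls≡t (cong₂ _,_ l≡th[t] l[sG]≡1))
    where
    G : Carrier
    G = eval F g s
    G≢0 : G ≢ 0#
    G≢0 = proj₁ (dual s≢0)
    t l : Carrier
    t = G ⁻¹
    l = s ⁻¹ * G ⁻¹
    l≢0 : l ≢ 0#
    l≢0 = *-nonzero (⁻¹-nonzero s≢0) (⁻¹-nonzero G≢0)
    ls≡t : l * s ≡ t
    ls≡t = begin
      s ⁻¹ * G ⁻¹ * s    ≡⟨ xy∙z≈y∙xz (s ⁻¹) (G ⁻¹) s ⟩
      G ⁻¹ * (s ⁻¹ * s)  ≡⟨ cong (G ⁻¹ *_) (⁻¹-inverseˡ s≢0) ⟩
      G ⁻¹ * 1#          ≡⟨ *-identityʳ t ⟩
      t                  ∎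
    l≡th[t] : l * 1# ≡ 0# + t * eval F h t
    l≡th[t] = begin
      s ⁻¹ * G ⁻¹ * 1#    ≡⟨ *-identityʳ l ⟩
      s ⁻¹ * G ⁻¹         ≡⟨ *-comm (s ⁻¹) t ⟩
      t * s ⁻¹            ≡⟨ cong (t *_) (sym (proj₂ (dual s≢0))) ⟩
      t * eval F h t      ≡⟨ sym (+-identityˡ _) ⟩
      0# + t * eval F h t ∎
    l[sG]≡1 : l * (0# + s * G) ≡ 1#
    l[sG]≡1 = begin
      s ⁻¹ * G ⁻¹ * (0# + s * G)  ≡⟨ cong (l *_) (+-identityˡ (s * G)) ⟩
      s ⁻¹ * G ⁻¹ * (s * G)       ≡⟨ interchange (s ⁻¹) (G ⁻¹) s G ⟩
      s ⁻¹ * s * (G ⁻¹ * G)       ≡⟨ cong₂ _*_ (⁻¹-inverseˡ s≢0) (⁻¹-inverseˡ G≢0) ⟩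
      1# * 1#                     ≡⟨ *-identityˡ 1# ⟩
      1#                          ∎

  swap-inS-xTimes : ∀ g h → DualOnUnits g h →
                    ∀ v → InS F (xTimes F g) v → InS F (xTimes F h) (swap v)
  swap-inS-xTimes g h dual v (inj₁ (s , v~P)) =
    inS-resp {xTimes F h} (samePoint-swap v~P) (swap-affinePoint-inS g h dual s)
  swap-inS-xTimes g h dual v (inj₂ v~∞) = inS-resp {xTimes F h} (samePoint-swap v~∞)
    (inj₁ (0# , ≡⇒samePoint nonZero-affine (cong (λ z → 0# , z , 1#) (sym (0+0*x≡0 (eval F h 0#))))))

theorem2p9 : (F : FiniteField) → (g : Poly F) →
    IsPermPoly F g → eval F g (FiniteField.0# F) ≡ FiniteField.0# F →
    (Σ (Poly F) λ h → IsPermPoly F h × IsInvDual F g h)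
    × ((h : Poly F) → IsPermPoly F h → IsInvDual F g h →
    ProjEquiv F (xTimes F g) (xTimes F h))
theorem2p9 F g g-perm g-0 =
  dualPermPoly g g-perm g-0 ,
  -- IsInvDual F g h determines h as a function.
  λ h _ h-dual → swap-projEquiv (xTimes F g) (xTimes F h)
    (swap-inS-xTimes g h (isInvDual⇒dualOnUnits g g-perm g-0 h h-dual))
    (swap-inS-xTimes h g (isInvDual⇒dualOnUnits-flipped g g-perm g-0 h h-dual))
  where
  open DualPermutation F
  open SwapCollineation F
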